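{- The generating series $S(z)=\sum_{n\geq 0}s(n)z^n$ and $T(z)=\sum_{n\geq 0}t(n)z^n$ satisfy the functional equations $$S(z^2)=\left(\frac{z}{1+z+z^2}\right)S(z)$$ and $$T(z^2)=\left(T(z)-2z\right)\left(\frac{ -z}{1+z+z^2}\right).$$
   Context: Stern's sequence is defined by $s(0)=0$, $s(1)=1$, and for $n\ge1$, $s(2n)=s(n)$, $s(2n+1)=s(n)+s(n+1)$. The twisted Stern sequence is defined by $t(0)=0$, $t(1)=1$, and for $n\ge1$, $t(2n)=-t(n)$, $t(2n+1)=-t(n)-t(n+1)$. -}

module Defs where

open import Data.Nat using (ℕ; zero; suc; _/_; _%_; _∸_)
open import Data.Integer using (ℤ; +_; _+_; _*_; -_)

-- Defined by the binary recursions, using a fuel argument (the first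
-- argument) which is always large enough: s n = sF n n, and every
-- recursive call decreases both the fuel and the index.

sF : ℕ → ℕ → ℤ
sF zero _ = + 0
sF (suc f) zero = + 0
sF (suc f) (suc zero) = + 1
sF (suc f) (suc (suc m)) with (suc (suc m)) % 2
... | zero  = sF f ((suc (suc m)) / 2)
... | suc _ = sF f ((suc (suc m)) / 2) + sF f (suc ((suc (suc m)) / 2))

s : ℕ → ℤ
s n = sF n n

tF : ℕ → ℕ → ℤ
tF zero _ = + 0
tF (suc f) zero = + 0
tF (suc f) (suc zero) = + 1
tF (suc f) (suc (suc m)) with (suc (suc m)) % 2
... | zero  = - tF f ((suc (suc m)) / 2)
... | suc _ = (- tF f ((suc (suc m)) / 2)) + (- tF f (suc ((suc (suc m)) / 2)))

t : ℕ → ℤ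
t n = tF n n

FPS : Set
FPS = ℕ → ℤ

sumTo : (ℕ → ℤ) → ℕ → ℤ
sumTo f zero = f zero
sumTo f (suc n) = sumTo f n + f (suc n)

_⊕_ : FPS → FPS → FPS
(a ⊕ b) n = a n + b n

⊖_ : FPS → FPS
(⊖ a) n = - a n

_⊛_ : FPS → FPS → FPS
(a ⊛ b) n = sumTo (λ k → a k * b (n ∸ k)) n

_·_ : ℤ → FPS → FPS
(c · a) n = c * a n

Z : FPS
Z (suc zero) = + 1
Z _ = + 0

onePlusZPlusZ² : FPS
onePlusZPlusZ² zero = + 1
onePlusZPlusZ² (suc zero) = + 1
onePlusZPlusZ² (suc (suc zero)) = + 1
onePlusZPlusZ² _ = + 0

sq : FPS → FPS
sq a n with n % 2
... | zero  = a (n / 2)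
... | suc _ = + 0

S T : FPS
S = s
T = t

-- Compare coefficients after multiplying by 1 + z + z². The coefficient of
-- z^(n+2) in A(z²)(1 + z + z²) is the sum of the coefficients of A(z²) at n,
-- n+1, n+2, i.e. a(k) + a(k+1) for n = 2k and a(k+1) for n = 2k+1. For A = S
-- these are s(2k+1) and s(2k+2) by the recurrences, the coefficients of z S(z).
-- For A = T the recurrences give the same up to sign; the term -2z is needed only
-- because the odd recurrence t(2n+1) = -t(n) - t(n+1) fails at n = 0.

module Submission where

open import Defs
open import Data.Nat using (ℕ; zero; suc; _≤_; _<_; z≤n; s≤s; _∸_; _/_; _%_) renaming (_*_ to _*ℕ_; _+_ to _+ℕ_)
open import Data.Nat.Properties using (≤-refl; ≤-trans; <⇒≤; <⇒≢; >⇒≢; ≤∧≢⇒<; m≤n⇒m<n∨m≡n; m≤n⇒m≤1+n; m≤m*n; n∸n≡0; m+n∸n≡m; +-∸-assoc)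
open import Data.Nat.DivMod using (m*n%n≡0; m*n/n≡m; [m+kn]%n≡m%n; +-distrib-/-∣ʳ; m/n<m; m/n≡1+[m∸n]/n)
open import Data.Nat.Divisibility using (divides)
open import Data.Integer using (ℤ; +_; _+_; _*_; -_)
open import Data.Integer.Properties using (+-identityˡ; +-identityʳ; *-identityˡ; *-identityʳ; *-zeroʳ; neg-distribʳ-*; neg-distrib-+; neg-involutive)
open import Data.Product using (_×_; _,_)
open import Data.Sum using (inj₁; inj₂)
open import Relation.Binary.PropositionalEquality using (_≡_; _≢_; refl; trans; cong; cong₂; module ≡-Reasoning)
open import Relation.Nullary using (contradiction)

open ≡-Reasoning

data Parity : ℕ → Set where
  even : ∀ k → Parity (k *ℕ 2)
  odd  : ∀ k → Parity (suc (k *ℕ 2))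

parity : ∀ n → Parity n
parity zero = even 0
parity (suc n) with parity n
... | even k = odd k
... | odd k  = even (suc k)

[k*2]%2≡0 : ∀ k → k *ℕ 2 % 2 ≡ 0
[k*2]%2≡0 k = m*n%n≡0 k 2

[k*2]/2≡k : ∀ k → k *ℕ 2 / 2 ≡ k
[k*2]/2≡k k = m*n/n≡m k 2

[1+k*2]%2≡1 : ∀ k → suc (k *ℕ 2) % 2 ≡ 1
[1+k*2]%2≡1 k = [m+kn]%n≡m%n 1 k 2

[1+k*2]/2≡k : ∀ k → suc (k *ℕ 2) / 2 ≡ k
[1+k*2]/2≡k k = trans (+-distrib-/-∣ʳ 1 {d = 2} (divides k refl)) ([k*2]/2≡k k)

[3+m]/2<2+m : ∀ m → (3 +ℕ m) / 2 < 2 +ℕ m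
[3+m]/2<2+m m rewrite m/n≡1+[m∸n]/n {3 +ℕ m} {2} (s≤s (s≤s z≤n)) =
  s≤s (m/n<m (1 +ℕ m) 2 (s≤s (s≤s z≤n)))

sF-even-step : ∀ f m → suc (suc m) % 2 ≡ 0 → sF (suc f) (suc (suc m)) ≡ sF f (suc (suc m) / 2)
sF-even-step f m eq rewrite eq = refl

sF-odd-step : ∀ f m → suc (suc m) % 2 ≡ 1 →
  sF (suc f) (suc (suc m)) ≡ sF f (suc (suc m) / 2) + sF f (suc (suc (suc m) / 2))
sF-odd-step f m eq rewrite eq = refl

tF-even-step : ∀ f m → suc (suc m) % 2 ≡ 0 → tF (suc f) (suc (suc m)) ≡ - tF f (suc (suc m) / 2)
tF-even-step f m eq rewrite eq = refl

tF-odd-step : ∀ f m → suc (suc m) % 2 ≡ 1 →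
  tF (suc f) (suc (suc m)) ≡ (- tF f (suc (suc m) / 2)) + (- tF f (suc (suc (suc m) / 2)))
tF-odd-step f m eq rewrite eq = refl

halves-fit-fuel : ∀ {m f} → 2 +ℕ m ≤ f → suc ((3 +ℕ m) / 2) ≤ f
halves-fit-fuel {m} = ≤-trans ([3+m]/2<2+m m)

sF-stable : ∀ {f g n} → n ≤ f → n ≤ g → sF f n ≡ sF g n
sF-stable {zero}  {zero}          _ _ = refl
sF-stable {zero}  {suc g} {zero}  _ _ = refl
sF-stable {suc f} {zero}  {zero}  _ _ = refl
sF-stable {suc f} {suc g} {zero}  _ _ = refl
sF-stable {suc f} {suc g} {1}     _ _ = refl
-- 2 % 2 reduces, so index 2 has no odd branch, whose call at 2 / 2 + 1 would exceed the fuel.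
sF-stable {suc f} {suc g} {2} (s≤s p) (s≤s q) = sF-stable p q
sF-stable {suc f} {suc g} {suc (suc (suc m))} (s≤s p) (s≤s q) with (3 +ℕ m) % 2
... | zero  = sF-stable (<⇒≤ (halves-fit-fuel p)) (<⇒≤ (halves-fit-fuel q))
... | suc _ = cong₂ _+_ (sF-stable (<⇒≤ (halves-fit-fuel p)) (<⇒≤ (halves-fit-fuel q)))
                        (sF-stable (halves-fit-fuel p) (halves-fit-fuel q))

tF-stable : ∀ {f g n} → n ≤ f → n ≤ g → tF f n ≡ tF g n
tF-stable {zero}  {zero}          _ _ = refl
tF-stable {zero}  {suc g} {zero}  _ _ = refl
tF-stable {suc f} {zero}  {zero}  _ _ = refl
tF-stable {suc f} {suc g} {zero}  _ _ = refl
tF-stable {suc f} {suc g} {1}     _ _ = refl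
tF-stable {suc f} {suc g} {2} (s≤s p) (s≤s q) = cong -_ (tF-stable p q)
tF-stable {suc f} {suc g} {suc (suc (suc m))} (s≤s p) (s≤s q) with (3 +ℕ m) % 2
... | zero  = cong -_ (tF-stable (<⇒≤ (halves-fit-fuel p)) (<⇒≤ (halves-fit-fuel q)))
... | suc _ = cong₂ (λ x y → (- x) + (- y))
                    (tF-stable (<⇒≤ (halves-fit-fuel p)) (<⇒≤ (halves-fit-fuel q)))
                    (tF-stable (halves-fit-fuel p) (halves-fit-fuel q))

sF≡s : ∀ {f n} → n ≤ f → sF f n ≡ s n
sF≡s n≤f = sF-stable n≤f ≤-refl

tF≡t : ∀ {f n} → n ≤ f → tF f n ≡ t n
tF≡t n≤f = tF-stable n≤f ≤-refl

k≤k*2 : ∀ k → k ≤ k *ℕ 2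
k≤k*2 k = m≤m*n k 2

s-even : ∀ k → s (k *ℕ 2) ≡ s k
s-even zero    = refl
s-even (suc k) = begin
  sF (suc (suc (k *ℕ 2))) (suc k *ℕ 2)  ≡⟨ sF-even-step (suc (k *ℕ 2)) (k *ℕ 2) ([k*2]%2≡0 (suc k)) ⟩
  sF (suc (k *ℕ 2)) (suc k *ℕ 2 / 2)     ≡⟨ cong (sF (suc (k *ℕ 2))) ([k*2]/2≡k (suc k)) ⟩
  sF (suc (k *ℕ 2)) (suc k)              ≡⟨ sF≡s (s≤s (k≤k*2 k)) ⟩
  s (suc k)                              ∎

s-odd : ∀ k → s (suc (k *ℕ 2)) ≡ s k + s (suc k)
s-odd zero    = refl
s-odd (suc k) = begin
  sF (suc (suc k *ℕ 2)) (suc (suc k *ℕ 2))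
    ≡⟨ sF-odd-step (suc k *ℕ 2) (suc (k *ℕ 2)) ([1+k*2]%2≡1 (suc k)) ⟩
  sF (suc k *ℕ 2) (suc (suc k *ℕ 2) / 2) + sF (suc k *ℕ 2) (suc (suc (suc k *ℕ 2) / 2))
    ≡⟨ cong (λ h → sF (suc k *ℕ 2) h + sF (suc k *ℕ 2) (suc h)) ([1+k*2]/2≡k (suc k)) ⟩
  sF (suc k *ℕ 2) (suc k) + sF (suc k *ℕ 2) (suc (suc k))
    ≡⟨ cong₂ _+_ (sF≡s (s≤s (m≤n⇒m≤1+n (k≤k*2 k)))) (sF≡s (s≤s (s≤s (k≤k*2 k)))) ⟩
  s (suc k) + s (suc (suc k))
    ∎

t-even : ∀ k → t (k *ℕ 2) ≡ - t k
t-even zero    = refl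
t-even (suc k) = begin
  tF (suc (suc (k *ℕ 2))) (suc k *ℕ 2)  ≡⟨ tF-even-step (suc (k *ℕ 2)) (k *ℕ 2) ([k*2]%2≡0 (suc k)) ⟩
  - tF (suc (k *ℕ 2)) (suc k *ℕ 2 / 2)   ≡⟨ cong (λ h → - tF (suc (k *ℕ 2)) h) ([k*2]/2≡k (suc k)) ⟩
  - tF (suc (k *ℕ 2)) (suc k)            ≡⟨ cong -_ (tF≡t (s≤s (k≤k*2 k))) ⟩
  - t (suc k)                            ∎

t-odd : ∀ k → t (suc (suc k *ℕ 2)) ≡ (- t (suc k)) + (- t (suc (suc k)))
t-odd k = begin
  tF (suc (suc k *ℕ 2)) (suc (suc k *ℕ 2))
    ≡⟨ tF-odd-step (suc k *ℕ 2) (suc (k *ℕ 2)) ([1+k*2]%2≡1 (suc k)) ⟩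
  (- tF (suc k *ℕ 2) (suc (suc k *ℕ 2) / 2)) + (- tF (suc k *ℕ 2) (suc (suc (suc k *ℕ 2) / 2)))
    ≡⟨ cong (λ h → (- tF (suc k *ℕ 2) h) + (- tF (suc k *ℕ 2) (suc h))) ([1+k*2]/2≡k (suc k)) ⟩
  (- tF (suc k *ℕ 2) (suc k)) + (- tF (suc k *ℕ 2) (suc (suc k)))
    ≡⟨ cong₂ (λ x y → (- x) + (- y)) (tF≡t (s≤s (m≤n⇒m≤1+n (k≤k*2 k)))) (tF≡t (s≤s (s≤s (k≤k*2 k)))) ⟩
  (- t (suc k)) + (- t (suc (suc k)))
    ∎

sq-even : ∀ a k → sq a (k *ℕ 2) ≡ a k
sq-even a k rewrite [k*2]%2≡0 k = cong a ([k*2]/2≡k k)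

sq-odd : ∀ a k → sq a (suc (k *ℕ 2)) ≡ + 0
sq-odd a k rewrite [1+k*2]%2≡1 k = refl

sumTo-vanishing : ∀ {f : ℕ → ℤ} n → (∀ {k} → k ≤ n → f k ≡ + 0) → sumTo f n ≡ + 0
sumTo-vanishing zero    off = off z≤n
sumTo-vanishing (suc n) off =
  cong₂ _+_ (sumTo-vanishing n (λ k≤n → off (m≤n⇒m≤1+n k≤n))) (off ≤-refl)

sumTo-single : ∀ {f : ℕ → ℤ} {i} n → i ≤ n → (∀ {k} → k ≤ n → k ≢ i → f k ≡ + 0) → sumTo f n ≡ f i
sumTo-single zero z≤n _ = refl
sumTo-single {f} {i} (suc n) i≤1+n off with m≤n⇒m<n∨m≡n i≤1+n
... | inj₁ (s≤s i≤n) = begin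
  sumTo f n + f (suc n) ≡⟨ cong₂ _+_ (sumTo-single n i≤n (λ k≤n → off (m≤n⇒m≤1+n k≤n)))
                                     (off ≤-refl (>⇒≢ (s≤s i≤n))) ⟩
  f i + + 0             ≡⟨ +-identityʳ (f i) ⟩
  f i                   ∎
... | inj₂ refl = begin
  sumTo f n + f (suc n) ≡⟨ cong (_+ f (suc n)) (sumTo-vanishing n (λ k≤n → off (m≤n⇒m≤1+n k≤n) (<⇒≢ (s≤s k≤n)))) ⟩
  + 0 + f (suc n)       ≡⟨ +-identityˡ (f (suc n)) ⟩
  f (suc n)             ∎

Z-vanishes : ∀ {k} → k ≢ 1 → Z k ≡ + 0
Z-vanishes {zero}          _   = refl
Z-vanishes {suc zero}      k≢1 = contradiction refl k≢1
Z-vanishes {suc (suc _)}   _   = refl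

*-onePlusZPlusZ²-≤2 : ∀ x {d} → d ≤ 2 → x * onePlusZPlusZ² d ≡ x
*-onePlusZPlusZ²-≤2 x z≤n               = *-identityʳ x
*-onePlusZPlusZ²-≤2 x (s≤s z≤n)         = *-identityʳ x
*-onePlusZPlusZ²-≤2 x (s≤s (s≤s z≤n))   = *-identityʳ x

⊛-onePlusZPlusZ² : ∀ a n → (a ⊛ onePlusZPlusZ²) (suc (suc n)) ≡ a n + a (suc n) + a (suc (suc n))
⊛-onePlusZPlusZ² a n =
  cong₂ _+_ (cong₂ _+_ lowest (weight (m+n∸n≡m 1 n) (s≤s z≤n))) (weight (n∸n≡0 n) z≤n)
  where
  coeff : ℕ → ℤ
  coeff k = a k * onePlusZPlusZ² (suc (suc n) ∸ k)
  weight : ∀ {k d} → suc (suc n) ∸ k ≡ d → d ≤ 2 → coeff k ≡ a k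
  weight {k} eq d≤2 = trans (cong (λ j → a k * onePlusZPlusZ² j) eq) (*-onePlusZPlusZ²-≤2 (a k) d≤2)
  beyond : ∀ {k} → k < n → coeff k ≡ + 0
  beyond {k} k<n = trans (cong (λ j → a k * onePlusZPlusZ² j) (+-∸-assoc 3 k<n)) (*-zeroʳ (a k))
  lowest : sumTo coeff n ≡ a n
  lowest = trans (sumTo-single n ≤-refl (λ k≤n k≢n → beyond (≤∧≢⇒< k≤n k≢n)))
                 (weight (m+n∸n≡m 2 n) ≤-refl)

Z-⊛ : ∀ b n → (Z ⊛ b) (suc n) ≡ b n
Z-⊛ b n = trans (sumTo-single (suc n) (s≤s z≤n) (λ {k} _ k≢1 → cong (_* b (suc n ∸ k)) (Z-vanishes k≢1)))
                (*-identityˡ (b n))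

⊛-⊖Z : ∀ c n → (c ⊛ (⊖ Z)) (suc n) ≡ - c n
⊛-⊖Z c n = begin
  sumTo coeff n + coeff (suc n)  ≡⟨ cong₂ _+_ lowest top ⟩
  - c n + + 0                    ≡⟨ +-identityʳ (- c n) ⟩
  - c n                          ∎
  where
  coeff : ℕ → ℤ
  coeff k = c k * (- Z (suc n ∸ k))
  top : coeff (suc n) ≡ + 0
  top = trans (cong (λ j → c (suc n) * (- Z j)) (n∸n≡0 n)) (*-zeroʳ (c (suc n)))
  beyond : ∀ {k} → k < n → coeff k ≡ + 0
  beyond {k} k<n = trans (cong (λ j → c k * (- Z j)) (+-∸-assoc 2 k<n)) (*-zeroʳ (c k))
  lowest : sumTo coeff n ≡ - c n
  lowest = begin
    sumTo coeff n          ≡⟨ sumTo-single n ≤-refl (λ k≤n k≢n → beyond (≤∧≢⇒< k≤n k≢n)) ⟩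
    c n * (- Z (suc n ∸ n)) ≡⟨ cong (λ j → c n * (- Z j)) (m+n∸n≡m 1 n) ⟩
    c n * (- + 1)           ≡⟨ neg-distribʳ-* (c n) (+ 1) ⟨
    - (c n * + 1)           ≡⟨ cong -_ (*-identityʳ (c n)) ⟩
    - c n                   ∎

sq-⊛-onePlusZPlusZ²-even : ∀ a k → (sq a ⊛ onePlusZPlusZ²) (suc k *ℕ 2) ≡ a k + a (suc k)
sq-⊛-onePlusZPlusZ²-even a k = begin
  (sq a ⊛ onePlusZPlusZ²) (suc k *ℕ 2)
    ≡⟨ ⊛-onePlusZPlusZ² (sq a) (k *ℕ 2) ⟩
  sq a (k *ℕ 2) + sq a (suc (k *ℕ 2)) + sq a (suc k *ℕ 2)
    ≡⟨ cong₂ _+_ (cong₂ _+_ (sq-even a k) (sq-odd a k)) (sq-even a (suc k)) ⟩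
  a k + + 0 + a (suc k)
    ≡⟨ cong (_+ a (suc k)) (+-identityʳ (a k)) ⟩
  a k + a (suc k)
    ∎

sq-⊛-onePlusZPlusZ²-odd : ∀ a k → (sq a ⊛ onePlusZPlusZ²) (suc (suc k *ℕ 2)) ≡ a (suc k)
sq-⊛-onePlusZPlusZ²-odd a k = begin
  (sq a ⊛ onePlusZPlusZ²) (suc (suc k *ℕ 2))
    ≡⟨ ⊛-onePlusZPlusZ² (sq a) (suc (k *ℕ 2)) ⟩
  sq a (suc (k *ℕ 2)) + sq a (suc k *ℕ 2) + sq a (suc (suc k *ℕ 2))
    ≡⟨ cong₂ _+_ (cong₂ _+_ (sq-odd a k) (sq-even a (suc k))) (sq-odd a (suc k)) ⟩
  + 0 + a (suc k) + + 0
    ≡⟨ trans (+-identityʳ _) (+-identityˡ (a (suc k))) ⟩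
  a (suc k)
    ∎

S-equation : ∀ n → (sq S ⊛ onePlusZPlusZ²) n ≡ (Z ⊛ S) n
S-equation 0 = refl
S-equation 1 = refl
S-equation (suc (suc n)) with parity n
... | even k = begin
  (sq S ⊛ onePlusZPlusZ²) (suc k *ℕ 2)  ≡⟨ sq-⊛-onePlusZPlusZ²-even S k ⟩
  s k + s (suc k)                       ≡⟨ s-odd k ⟨
  s (suc (k *ℕ 2))                      ≡⟨ Z-⊛ S (suc (k *ℕ 2)) ⟨
  (Z ⊛ S) (suc k *ℕ 2)                  ∎
... | odd k = begin
  (sq S ⊛ onePlusZPlusZ²) (suc (suc k *ℕ 2))  ≡⟨ sq-⊛-onePlusZPlusZ²-odd S k ⟩
  s (suc k)                                   ≡⟨ s-even (suc k) ⟨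
  s (suc k *ℕ 2)                              ≡⟨ Z-⊛ S (suc k *ℕ 2) ⟨
  (Z ⊛ S) (suc (suc k *ℕ 2))                  ∎

T-2Z-⊛-⊖Z : ∀ n → ((T ⊕ (⊖ ((+ 2) · Z))) ⊛ (⊖ Z)) (suc (suc (suc n))) ≡ - t (suc (suc n))
T-2Z-⊛-⊖Z n = trans (⊛-⊖Z (T ⊕ (⊖ ((+ 2) · Z))) (suc (suc n))) (cong -_ (+-identityʳ (t (suc (suc n)))))

T-equation : ∀ n → (sq T ⊛ onePlusZPlusZ²) n ≡ ((T ⊕ (⊖ ((+ 2) · Z))) ⊛ (⊖ Z)) n
T-equation 0 = refl
T-equation 1 = refl
T-equation 2 = refl
T-equation (suc (suc (suc n))) with parity n
... | even k = begin
  (sq T ⊛ onePlusZPlusZ²) (suc (suc k *ℕ 2))  ≡⟨ sq-⊛-onePlusZPlusZ²-odd T k ⟩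
  t (suc k)                                   ≡⟨ neg-involutive (t (suc k)) ⟨
  - - t (suc k)                               ≡⟨ cong -_ (t-even (suc k)) ⟨
  - t (suc k *ℕ 2)                            ≡⟨ T-2Z-⊛-⊖Z (k *ℕ 2) ⟨
  ((T ⊕ (⊖ ((+ 2) · Z))) ⊛ (⊖ Z)) (suc (suc k *ℕ 2)) ∎
... | odd k = begin
  (sq T ⊛ onePlusZPlusZ²) (suc (suc k) *ℕ 2)       ≡⟨ sq-⊛-onePlusZPlusZ²-even T (suc k) ⟩
  t (suc k) + t (suc (suc k))                      ≡⟨ cong₂ _+_ (neg-involutive (t (suc k))) (neg-involutive (t (suc (suc k)))) ⟨
  (- - t (suc k)) + (- - t (suc (suc k)))          ≡⟨ neg-distrib-+ (- t (suc k)) (- t (suc (suc k))) ⟨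
  - ((- t (suc k)) + (- t (suc (suc k))))          ≡⟨ cong -_ (t-odd k) ⟨
  - t (suc (suc k *ℕ 2))                           ≡⟨ T-2Z-⊛-⊖Z (suc (k *ℕ 2)) ⟨
  ((T ⊕ (⊖ ((+ 2) · Z))) ⊛ (⊖ Z)) (suc (suc k) *ℕ 2) ∎

lemma2p1 : ((n : ℕ) → (sq S ⊛ onePlusZPlusZ²) n ≡ (Z ⊛ S) n)
    × ((n : ℕ) → (sq T ⊛ onePlusZPlusZ²) n ≡ ((T ⊕ (⊖ ((+ 2) · Z))) ⊛ (⊖ Z)) n)
lemma2p1 = S-equation , T-equation
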